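{- Let $G\cong\{a\mid b\}$ where $a$, $b$, $G$ are numbers and $b-G=\frac{1}{2^p}$ for some integer $p\ge0$. Then for every integer $k>0$, \[G\mathbin{:}k=G+\frac{1}{2^p}-\frac{1}{2^{p+k}}.\]
   Context: Games are short normal-play combinatorial games with the usual disjunctive sum, order and equality; numbers are games whose options are numbers and whose Left options are all strictly less than its Right options, with values identified with dyadic rationals. The integer $k$ is in canonical form ($0\cong\{\mid\}$, $k+1\cong\{k\mid\}$). The ordinal sum is $G\mathbin{:}H\cong\{L(G),G\mathbin{:}H^L\mid R(G),G\mathbin{:}H^R\}$. -}

module Defs where

open import Data.Nat using (ℕ; zero; suc) renaming (_+_ to _+ℕ_)
open import Data.Fin using (Fin; splitAt)
open import Data.Sum using (_⊎_; [_,_]′)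
open import Data.Product using (_×_; Σ)
open import Relation.Nullary using (¬_)

-- Short games: finitely many Left options and finitely many Right options,
-- indexed by Fin.  mk m L n R  is  { L 0 , ... , L (m-1) | R 0 , ... , R (n-1) }.
data Game : Set where
  mk : (m : ℕ) → (Fin m → Game) → (n : ℕ) → (Fin n → Game) → Game

nL nR : Game → ℕ
nL (mk m _ _ _) = m
nR (mk _ _ n _) = n

GL : (G : Game) → Fin (nL G) → Game
GL (mk _ L _ _) = L
GR : (G : Game) → Fin (nR G) → Game
GR (mk _ _ _ R) = R

infix 4 _≤_ _<_ _≈_
_≤_ : Game → Game → Set
mk m L n R ≤ mk m′ L′ n′ R′ =
  (∀ i → ¬ (mk m′ L′ n′ R′ ≤ L i)) × (∀ j → ¬ (R′ j ≤ mk m L n R))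

_<_ : Game → Game → Set
G < H = G ≤ H × ¬ (H ≤ G)

_≈_ : Game → Game → Set
G ≈ H = G ≤ H × H ≤ G

-- Disjunctive sum: G + H = { G^L + H, G + H^L | G^R + H, G + H^R }.
infixl 6 _+_ _-_
_+_ : Game → Game → Game
mk m L n R + mk m′ L′ n′ R′ =
  mk (m +ℕ m′) (λ k → [ (λ i → L i + mk m′ L′ n′ R′) , (λ i → mk m L n R + L′ i) ]′ (splitAt m k))
     (n +ℕ n′) (λ k → [ (λ j → R j + mk m′ L′ n′ R′) , (λ j → mk m L n R + R′ j) ]′ (splitAt n k))

-_ : Game → Game
- mk m L n R = mk n (λ j → - R j) m (λ i → - L i)

_-_ : Game → Game → Game
G - H = G + (- H)

IsNumber : Game → Set
IsNumber (mk m L n R) =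
  (∀ i → IsNumber (L i)) × (∀ j → IsNumber (R j)) × (∀ i j → L i < R j)

⟨_∣_⟩ : Game → Game → Game
⟨ a ∣ b ⟩ = mk 1 (λ _ → a) 1 (λ _ → b)

0G : Game
0G = mk 0 (λ ()) 0 (λ ())

int : ℕ → Game
int zero = 0G
int (suc k) = mk 1 (λ _ → int k) 0 (λ ())

inv2^ : ℕ → Game
inv2^ zero = int 1
inv2^ (suc p) = mk 1 (λ _ → 0G) 1 (λ _ → inv2^ p)

-- Ordinal sum: G : H = { G^L, G : H^L | G^R, G : H^R }  (recursion on H).
infixl 7 _∶_
_∶_ : Game → Game → Game
G ∶ mk m L n R =
  mk (nL G +ℕ m) (λ k → [ GL G , (λ i → G ∶ L i) ]′ (splitAt (nL G) k))
     (nR G +ℕ n) (λ k → [ GR G , (λ j → G ∶ R j) ]′ (splitAt (nR G) k))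

{-# OPTIONS --safe #-}

-- Write G = {a | b}, x = 2^-p and X k = G : k, so that b = G + x.  By induction,
-- X k = b - 2^-(p+k): X (k+1) = {a, X k | b} equals X k + t with t = 2^-(p+k+1).
-- The upper bound X (k+1) ≤ X k + t is a direct check of options.  For the
-- lower bound b - t ≤ X (k+1), G is replaced by an equal game C whose Left
-- options all lie at least x below C; C is a multiple of x minus a game with no
-- Right options, and an Archimedean search finds it up to double negation,
-- which suffices because ≤ is ¬¬-stable.

module Submission where

open import Defs
open import Algebra.Bundles using (AbelianGroup)
open import Algebra.Structures {A = Game} _≈_ using (IsAbelianGroup)
import Algebra.Properties.CommutativeSemigroup as CommutativeSemigroupProperties
import Algebra.Properties.Group as GroupProperties
open import Data.Fin using (zero; suc; splitAt; _↑ˡ_; _↑ʳ_)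
open import Data.Fin.Properties using (splitAt-↑ˡ; splitAt-↑ʳ)
open import Data.List using (tabulate)
open import Data.List.Relation.Unary.Any.Properties using (tabulate⁺)
open import Data.Nat using (ℕ; zero; suc; s≤s) renaming (_<_ to _<ℕ_; _+_ to _+ℕ_; _≤_ to _≤ℕ_)
import Data.Nat.Properties as ℕ
open import Data.List.Extrema ℕ.≤-totalOrder using (max; v≤max⁺)
open import Data.Product using (_×_; ∃-syntax; _,_; proj₁; proj₂)
open import Data.Sum using (inj₁; inj₂; [_,_]′)
open import Relation.Binary.Bundles using (Poset)
open import Relation.Binary.Structures using (IsEquivalence; IsPartialOrder)
open import Relation.Binary.PropositionalEquality using (_≡_; refl; sym; cong; subst)
open import Relation.Nullary using (¬_)
open import Relation.Nullary.Negation using (¬¬-map)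

infix 4 _∈ᴸ_ _∈ᴿ_ _≤ᴸ_ _≥ᴿ_

_∈ᴸ_ _∈ᴿ_ : Game → Game → Set
X ∈ᴸ G = ∃[ i ] GL G i ≡ X
X ∈ᴿ G = ∃[ j ] GR G j ≡ X

≤-intro : ∀ G H → (∀ i → ¬ H ≤ GL G i) → (∀ j → ¬ GR H j ≤ G) → G ≤ H
≤-intro (mk _ _ _ _) (mk _ _ _ _) noLeft noRight = noLeft , noRight

≤-elimᴸ : ∀ {G H X} → G ≤ H → X ∈ᴸ G → ¬ H ≤ X
≤-elimᴸ {mk _ _ _ _} {mk _ _ _ _} (noLeft , _) (i , refl) = noLeft i

≤-elimᴿ : ∀ {G H X} → G ≤ H → X ∈ᴿ H → ¬ X ≤ G
≤-elimᴿ {mk _ _ _ _} {mk _ _ _ _} (_ , noRight) (j , refl) = noRight j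

≤-refl : ∀ {G} → G ≤ G
≤-refl {mk _ L _ R} =
  (λ i G≤Lᵢ → ≤-elimᴸ G≤Lᵢ (i , refl) ≤-refl) ,
  (λ j Rⱼ≤G → ≤-elimᴿ Rⱼ≤G (j , refl) ≤-refl)

≤-trans : ∀ {G H K} → G ≤ H → H ≤ K → G ≤ K
≤-trans {mk _ _ _ _} {H} {mk _ _ _ _} G≤H H≤K =
  (λ i K≤Gᴸ → ≤-elimᴸ G≤H (i , refl) (≤-trans H≤K K≤Gᴸ)) ,
  (λ j Kᴿ≤G → ≤-elimᴿ H≤K (j , refl) (≤-trans Kᴿ≤G G≤H))

∈ᴸ⇒≰ : ∀ {G X} → X ∈ᴸ G → ¬ G ≤ X
∈ᴸ⇒≰ {G} = ≤-elimᴸ (≤-refl {G})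

∈ᴿ⇒≰ : ∀ {G X} → X ∈ᴿ G → ¬ X ≤ G
∈ᴿ⇒≰ {G} = ≤-elimᴿ (≤-refl {G})

≈-sym : ∀ {G H} → G ≈ H → H ≈ G
≈-sym (G≤H , H≤G) = H≤G , G≤H

≈-trans : ∀ {G H K} → G ≈ H → H ≈ K → G ≈ K
≈-trans (G≤H , H≤G) (H≤K , K≤H) = ≤-trans G≤H H≤K , ≤-trans K≤H H≤G

≈-isEquivalence : IsEquivalence _≈_
≈-isEquivalence = record { refl = ≤-refl , ≤-refl ; sym = ≈-sym ; trans = ≈-trans }

≤-isPartialOrder : IsPartialOrder _≈_ _≤_
≤-isPartialOrder = record
  { isPreorder = record { isEquivalence = ≈-isEquivalence ; reflexive = proj₁ ; trans = ≤-trans }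
  ; antisym = _,_
  }

≤-poset : Poset _ _ _
≤-poset = record { isPartialOrder = ≤-isPartialOrder }

open import Relation.Binary.Reasoning.PartialOrder ≤-poset

≤-stable : ∀ {G H} → ¬ ¬ G ≤ H → G ≤ H
≤-stable {mk _ _ _ _} {mk _ _ _ _} ¬¬G≤H =
  (λ i H≤Gᴸ → ¬¬G≤H λ G≤H → proj₁ G≤H i H≤Gᴸ) ,
  (λ j Hᴿ≤G → ¬¬G≤H λ G≤H → proj₂ G≤H j Hᴿ≤G)

≈-stable : ∀ {G H} → ¬ ¬ G ≈ H → G ≈ H
≈-stable ¬¬G≈H = ≤-stable (¬¬-map proj₁ ¬¬G≈H) , ≤-stable (¬¬-map proj₂ ¬¬G≈H)

_≤ᴸ_ _≥ᴿ_ : Game → Game → Set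
X ≤ᴸ H = ∃[ Y ] Y ∈ᴸ H × X ≤ Y
X ≥ᴿ G = ∃[ Y ] Y ∈ᴿ G × Y ≤ X

≤-byOptions : ∀ G H → (∀ i → GL G i ≤ᴸ H) → (∀ j → GR H j ≥ᴿ G) → G ≤ H
≤-byOptions G H dominatedᴸ dominatedᴿ = ≤-intro G H
  (λ i H≤Gᴸ → let (Y , Y∈ᴸH , Gᴸ≤Y) = dominatedᴸ i in ∈ᴸ⇒≰ Y∈ᴸH (≤-trans H≤Gᴸ Gᴸ≤Y))
  (λ j Hᴿ≤G → let (Y , Y∈ᴿG , Y≤Hᴿ) = dominatedᴿ j in ∈ᴿ⇒≰ Y∈ᴿG (≤-trans Y≤Hᴿ Hᴿ≤G))

+-∈ᴸˡ : ∀ G H {X} → X ∈ᴸ G → X + H ∈ᴸ G + H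
+-∈ᴸˡ G@(mk m L _ _) H@(mk m′ L′ _ _) (i , refl) =
  i ↑ˡ m′ , cong [ (λ i → L i + H) , (λ i → G + L′ i) ]′ (splitAt-↑ˡ m i m′)

+-∈ᴸʳ : ∀ G H {X} → X ∈ᴸ H → G + X ∈ᴸ G + H
+-∈ᴸʳ G@(mk m L _ _) H@(mk m′ L′ _ _) (i , refl) =
  m ↑ʳ i , cong [ (λ i → L i + H) , (λ i → G + L′ i) ]′ (splitAt-↑ʳ m m′ i)

+-∈ᴿˡ : ∀ G H {X} → X ∈ᴿ G → X + H ∈ᴿ G + H
+-∈ᴿˡ G@(mk _ _ n R) H@(mk _ _ n′ R′) (j , refl) =
  j ↑ˡ n′ , cong [ (λ j → R j + H) , (λ j → G + R′ j) ]′ (splitAt-↑ˡ n j n′)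

+-∈ᴿʳ : ∀ G H {X} → X ∈ᴿ H → G + X ∈ᴿ G + H
+-∈ᴿʳ G@(mk _ _ n R) H@(mk _ _ n′ R′) (j , refl) =
  n ↑ʳ j , cong [ (λ j → R j + H) , (λ j → G + R′ j) ]′ (splitAt-↑ʳ n n′ j)

+-elimᴸ : ∀ G H (P : Game → Set) → (∀ i → P (GL G i + H)) → (∀ i → P (G + GL H i)) →
          ∀ k → P (GL (G + H) k)
+-elimᴸ (mk m _ _ _) (mk _ _ _ _) P onG onH k with splitAt m k
... | inj₁ i = onG i
... | inj₂ i = onH i

+-elimᴿ : ∀ G H (P : Game → Set) → (∀ j → P (GR G j + H)) → (∀ j → P (G + GR H j)) →
          ∀ k → P (GR (G + H) k)
+-elimᴿ (mk _ _ n _) (mk _ _ _ _) P onG onH k with splitAt n k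
... | inj₁ j = onG j
... | inj₂ j = onH j

-- Games form an ordered abelian group

+-comm-≤ : ∀ G H → G + H ≤ H + G
+-comm-≤ G@(mk _ L _ R) H@(mk _ L′ _ R′) = ≤-byOptions (G + H) (H + G)
  (+-elimᴸ G H (_≤ᴸ H + G)
     (λ i → H + L i , +-∈ᴸʳ H G (i , refl) , +-comm-≤ (L i) H)
     (λ i → L′ i + G , +-∈ᴸˡ H G (i , refl) , +-comm-≤ G (L′ i)))
  (+-elimᴿ H G (_≥ᴿ G + H)
     (λ j → G + R′ j , +-∈ᴿʳ G H (j , refl) , +-comm-≤ G (R′ j))
     (λ j → R j + H , +-∈ᴿˡ G H (j , refl) , +-comm-≤ (R j) H))

+-comm : ∀ G H → G + H ≈ H + G
+-comm G H = +-comm-≤ G H , +-comm-≤ H G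

+-identityʳ : ∀ G → G + 0G ≈ G
+-identityʳ G@(mk _ L _ R) =
  ≤-byOptions (G + 0G) G
    (+-elimᴸ G 0G (_≤ᴸ G) (λ i → L i , (i , refl) , proj₁ (+-identityʳ (L i))) (λ ()))
    (λ j → R j + 0G , +-∈ᴿˡ G 0G (j , refl) , proj₁ (+-identityʳ (R j))) ,
  ≤-byOptions G (G + 0G)
    (λ i → L i + 0G , +-∈ᴸˡ G 0G (i , refl) , proj₂ (+-identityʳ (L i)))
    (+-elimᴿ G 0G (_≥ᴿ G) (λ j → R j , (j , refl) , proj₂ (+-identityʳ (R j))) (λ ()))

+-identityˡ : ∀ G → 0G + G ≈ G
+-identityˡ G = ≈-trans (+-comm 0G G) (+-identityʳ G)

+-assoc-≤ : ∀ G H K → (G + H) + K ≤ G + (H + K)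
+-assoc-≤ G@(mk _ L _ R) H@(mk _ L′ _ R′) K@(mk _ L″ _ R″) =
  ≤-byOptions ((G + H) + K) (G + (H + K))
    (+-elimᴸ (G + H) K (_≤ᴸ G + (H + K))
      (+-elimᴸ G H (λ Y → Y + K ≤ᴸ G + (H + K))
        (λ i → L i + (H + K) , +-∈ᴸˡ G (H + K) (i , refl) , +-assoc-≤ (L i) H K)
        (λ i → G + (L′ i + K) , +-∈ᴸʳ G (H + K) (+-∈ᴸˡ H K (i , refl)) , +-assoc-≤ G (L′ i) K))
      (λ i → G + (H + L″ i) , +-∈ᴸʳ G (H + K) (+-∈ᴸʳ H K (i , refl)) , +-assoc-≤ G H (L″ i)))
    (+-elimᴿ G (H + K) (_≥ᴿ (G + H) + K)
      (λ j → (R j + H) + K , +-∈ᴿˡ (G + H) K (+-∈ᴿˡ G H (j , refl)) , +-assoc-≤ (R j) H K)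
      (+-elimᴿ H K (λ Y → G + Y ≥ᴿ (G + H) + K)
        (λ j → (G + R′ j) + K , +-∈ᴿˡ (G + H) K (+-∈ᴿʳ G H (j , refl)) , +-assoc-≤ G (R′ j) K)
        (λ j → (G + H) + R″ j , +-∈ᴿʳ (G + H) K (j , refl) , +-assoc-≤ G H (R″ j))))

+-assoc : ∀ G H K → (G + H) + K ≈ G + (H + K)
+-assoc G H K = +-assoc-≤ G H K , (begin
  G + (H + K)  ≤⟨ +-comm-≤ G (H + K) ⟩
  (H + K) + G  ≤⟨ +-assoc-≤ H K G ⟩
  H + (K + G)  ≤⟨ +-comm-≤ H (K + G) ⟩
  (K + G) + H  ≤⟨ +-assoc-≤ K G H ⟩
  K + (G + H)  ≤⟨ +-comm-≤ K (G + H) ⟩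
  (G + H) + K  ∎)

+-monoˡ-≤ : ∀ {G G′} H → G ≤ G′ → G + H ≤ G′ + H
+-cancelʳ-≤ : ∀ {G G′} H → G + H ≤ G′ + H → G ≤ G′

+-monoˡ-≤ {G@(mk _ L _ _)} {G′@(mk _ _ _ R′)} H@(mk _ L″ _ R″) G≤G′ = ≤-intro (G + H) (G′ + H)
  (+-elimᴸ G H (λ Y → ¬ G′ + H ≤ Y)
     (λ i G′+H≤Lᵢ+H → ≤-elimᴸ G≤G′ (i , refl) (+-cancelʳ-≤ H G′+H≤Lᵢ+H))
     (λ i G′+H≤G+L″ᵢ →
        ∈ᴸ⇒≰ (+-∈ᴸʳ G′ H (i , refl)) (≤-trans G′+H≤G+L″ᵢ (+-monoˡ-≤ (L″ i) G≤G′))))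
  (+-elimᴿ G′ H (λ Y → ¬ Y ≤ G + H)
     (λ j R′ⱼ+H≤G+H → ≤-elimᴿ G≤G′ (j , refl) (+-cancelʳ-≤ H R′ⱼ+H≤G+H))
     (λ j G′+R″ⱼ≤G+H →
        ∈ᴿ⇒≰ (+-∈ᴿʳ G H (j , refl)) (≤-trans (+-monoˡ-≤ (R″ j) G≤G′) G′+R″ⱼ≤G+H)))

+-cancelʳ-≤ {G@(mk _ L _ _)} {G′@(mk _ _ _ R′)} H@(mk _ _ _ _) G+H≤G′+H = ≤-intro G G′
  (λ i G′≤Lᵢ → ∈ᴸ⇒≰ (+-∈ᴸˡ G H (i , refl)) (≤-trans G+H≤G′+H (+-monoˡ-≤ H G′≤Lᵢ)))
  (λ j R′ⱼ≤G → ∈ᴿ⇒≰ (+-∈ᴿˡ G′ H (j , refl)) (≤-trans (+-monoˡ-≤ H R′ⱼ≤G) G+H≤G′+H))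

+-monoʳ-≤ : ∀ G {H H′} → H ≤ H′ → G + H ≤ G + H′
+-monoʳ-≤ G {H} {H′} H≤H′ = begin
  G + H   ≤⟨ +-comm-≤ G H ⟩
  H + G   ≤⟨ +-monoˡ-≤ G H≤H′ ⟩
  H′ + G  ≤⟨ +-comm-≤ H′ G ⟩
  G + H′  ∎

+-mono-≤ : ∀ {G G′ H H′} → G ≤ G′ → H ≤ H′ → G + H ≤ G′ + H′
+-mono-≤ {G′ = G′} {H} G≤G′ H≤H′ = ≤-trans (+-monoˡ-≤ H G≤G′) (+-monoʳ-≤ G′ H≤H′)

+-cancelˡ-≤ : ∀ G {H H′} → G + H ≤ G + H′ → H ≤ H′
+-cancelˡ-≤ G {H} {H′} G+H≤G+H′ = +-cancelʳ-≤ G (begin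
  H + G   ≤⟨ +-comm-≤ H G ⟩
  G + H   ≤⟨ G+H≤G+H′ ⟩
  G + H′  ≤⟨ +-comm-≤ G H′ ⟩
  H′ + G  ∎)

+-cong : ∀ {G G′ H H′} → G ≈ G′ → H ≈ H′ → G + H ≈ G′ + H′
+-cong (G≤G′ , G′≤G) (H≤H′ , H′≤H) = +-mono-≤ G≤G′ H≤H′ , +-mono-≤ G′≤G H′≤H

neg-antimono-≤ : ∀ {G H} → G ≤ H → - H ≤ - G
neg-cancel-≤ : ∀ {G H} → - H ≤ - G → G ≤ H

neg-antimono-≤ {G@(mk _ L _ _)} {H@(mk _ _ _ R′)} G≤H = ≤-intro (- H) (- G)
  (λ j -G≤-R′ⱼ → ≤-elimᴿ G≤H (j , refl) (neg-cancel-≤ -G≤-R′ⱼ))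
  (λ i -Lᵢ≤-H → ≤-elimᴸ G≤H (i , refl) (neg-cancel-≤ -Lᵢ≤-H))

neg-cancel-≤ {G@(mk _ L _ _)} {H@(mk _ _ _ R′)} -H≤-G = ≤-intro G H
  (λ i H≤Lᵢ → ∈ᴿ⇒≰ (i , refl) (≤-trans (neg-antimono-≤ H≤Lᵢ) -H≤-G))
  (λ j R′ⱼ≤G → ∈ᴸ⇒≰ (j , refl) (≤-trans -H≤-G (neg-antimono-≤ R′ⱼ≤G)))

-‿cong : ∀ {G H} → G ≈ H → - G ≈ - H
-‿cong (G≤H , H≤G) = neg-antimono-≤ H≤G , neg-antimono-≤ G≤H

-- The mirror strategy: each option of G - G is answered by its mirror image.
+-inverseʳ : ∀ G → G - G ≈ 0G
+-inverseʳ G@(mk _ L _ R) =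
  ≤-intro (G - G) 0G
    (+-elimᴸ G (- G) (λ Y → ¬ 0G ≤ Y)
       (λ i 0≤Lᵢ-G → ≤-elimᴿ 0≤Lᵢ-G (+-∈ᴿʳ (L i) (- G) (i , refl)) (proj₁ (+-inverseʳ (L i))))
       (λ j 0≤G-Rⱼ → ≤-elimᴿ 0≤G-Rⱼ (+-∈ᴿˡ G (- R j) (j , refl)) (proj₁ (+-inverseʳ (R j)))))
    (λ ()) ,
  ≤-intro 0G (G - G) (λ ())
    (+-elimᴿ G (- G) (λ Y → ¬ Y ≤ 0G)
       (λ j Rⱼ-G≤0 → ≤-elimᴸ Rⱼ-G≤0 (+-∈ᴸʳ (R j) (- G) (j , refl)) (proj₂ (+-inverseʳ (R j))))
       (λ i G-Lᵢ≤0 → ≤-elimᴸ G-Lᵢ≤0 (+-∈ᴸˡ G (- L i) (i , refl)) (proj₂ (+-inverseʳ (L i)))))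

+-inverseˡ : ∀ G → - G + G ≈ 0G
+-inverseˡ G = ≈-trans (+-comm (- G) G) (+-inverseʳ G)

+-isAbelianGroup : IsAbelianGroup _+_ 0G (-_)
+-isAbelianGroup = record
  { isGroup = record
    { isMonoid = record
      { isSemigroup = record
        { isMagma = record { isEquivalence = ≈-isEquivalence ; ∙-cong = +-cong }
        ; assoc = +-assoc
        }
      ; identity = +-identityˡ , +-identityʳ
      }
    ; inverse = +-inverseˡ , +-inverseʳ
    ; ⁻¹-cong = -‿cong
    }
  ; comm = +-comm
  }

+-abelianGroup : AbelianGroup _ _
+-abelianGroup = record { isAbelianGroup = +-isAbelianGroup }

open AbelianGroup +-abelianGroup using () renaming (∙-congˡ to +-congˡ; ∙-congʳ to +-congʳ)
open GroupProperties (AbelianGroup.group +-abelianGroup)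
  using (//-rightDividesˡ; //-rightDividesʳ; x≈z//y; ε⁻¹≈ε)
open CommutativeSemigroupProperties (AbelianGroup.commutativeSemigroup +-abelianGroup)
  using (xy∙z≈xz∙y)

x≤z-y⇒x+y≤z : ∀ {G H} J → G ≤ H - J → G + J ≤ H
x≤z-y⇒x+y≤z {G} {H} J G≤H-J = begin
  G + J        ≤⟨ +-monoˡ-≤ J G≤H-J ⟩
  (H - J) + J  ≈⟨ //-rightDividesˡ J H ⟩
  H            ∎

x+y≤z⇒x≤z-y : ∀ {G H} J → G + J ≤ H → G ≤ H - J
x+y≤z⇒x≤z-y {G} {H} J G+J≤H = begin
  G            ≈⟨ //-rightDividesʳ J G ⟨
  (G + J) - J  ≤⟨ +-monoˡ-≤ (- J) G+J≤H ⟩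
  H - J        ∎

x≤x+y : ∀ G {H} → 0G ≤ H → G ≤ G + H
x≤x+y G {H} 0≤H = begin
  G       ≈⟨ +-identityʳ G ⟨
  G + 0G  ≤⟨ +-monoʳ-≤ G 0≤H ⟩
  G + H   ∎

x+y≰x : ∀ G {H} → ¬ H ≤ 0G → ¬ G + H ≤ G
x+y≰x G H≰0 G+H≤G = H≰0 (+-cancelˡ-≤ G (≤-trans G+H≤G (proj₂ (+-identityʳ G))))

-- Dyadic fractions

0∈ᴸinv2^ : ∀ n → 0G ∈ᴸ inv2^ n
0∈ᴸinv2^ zero = zero , refl
0∈ᴸinv2^ (suc n) = zero , refl

inv2^-leftOption≤0 : ∀ n i → GL (inv2^ n) i ≤ 0G
inv2^-leftOption≤0 zero zero = ≤-refl
inv2^-leftOption≤0 (suc n) zero = ≤-refl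

inv2^-positive : ∀ n → 0G < inv2^ n
inv2^-positive zero = ≤-intro 0G (inv2^ zero) (λ ()) (λ ()) , ∈ᴸ⇒≰ (0∈ᴸinv2^ zero)
inv2^-positive (suc n) =
  ≤-intro 0G (inv2^ (suc n)) (λ ()) (λ { zero → proj₂ (inv2^-positive n) }) ,
  ∈ᴸ⇒≰ (0∈ᴸinv2^ (suc n))

inv2^≰half : ∀ n → ¬ inv2^ n ≤ inv2^ (suc n)
inv2^≰half n = ∈ᴿ⇒≰ {inv2^ (suc n)} (zero , refl)

inv2^-suc-≤ : ∀ n → inv2^ (suc n) ≤ inv2^ n
inv2^-suc-≤ zero = ≤-intro (inv2^ 1) (inv2^ 0) (λ { zero → proj₂ (inv2^-positive 0) }) (λ ())
inv2^-suc-≤ (suc n) = ≤-intro (inv2^ (suc (suc n))) (inv2^ (suc n))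
  (λ { zero → proj₂ (inv2^-positive (suc n)) })
  (λ { zero x≤x/4 → inv2^≰half (suc n) (≤-trans (inv2^-suc-≤ n) x≤x/4) })

inv2^-antimono : ∀ p d → inv2^ (p +ℕ d) ≤ inv2^ p
inv2^-antimono p zero rewrite ℕ.+-identityʳ p = ≤-refl
inv2^-antimono p (suc d) rewrite ℕ.+-suc p d = ≤-trans (inv2^-suc-≤ (p +ℕ d)) (inv2^-antimono p d)

inv2^-half-≤ : ∀ n → inv2^ (suc n) + inv2^ (suc n) ≤ inv2^ n
inv2^-half-≤ zero = ≤-intro (inv2^ 1 + inv2^ 1) (inv2^ 0)
  (+-elimᴸ (inv2^ 1) (inv2^ 1) (λ Y → ¬ inv2^ 0 ≤ Y)
    (λ { zero 1≤0+h → inv2^≰half 0 (≤-trans 1≤0+h (proj₁ (+-identityˡ (inv2^ 1)))) })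
    (λ { zero 1≤h+0 → inv2^≰half 0 (≤-trans 1≤h+0 (proj₁ (+-identityʳ (inv2^ 1)))) }))
  (λ ())
inv2^-half-≤ (suc n) = ≤-intro (h + h) z
  (+-elimᴸ h h (λ Y → ¬ z ≤ Y)
    (λ { zero z≤0+h → inv2^≰half (suc n) (≤-trans z≤0+h (proj₁ (+-identityˡ h))) })
    (λ { zero z≤h+0 → inv2^≰half (suc n) (≤-trans z≤h+0 (proj₁ (+-identityʳ h))) }))
  (λ { zero y≤h+h → inv2^≰half (suc n) (+-cancelʳ-≤ z (begin
      z + z  ≤⟨ inv2^-half-≤ n ⟩
      inv2^ n  ≤⟨ y≤h+h ⟩
      h + h  ≤⟨ +-monoʳ-≤ h (inv2^-suc-≤ (suc n)) ⟩
      h + z  ∎)) })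
  where
  z h : Game
  z = inv2^ (suc n)
  h = inv2^ (suc (suc n))

inv2^-half-≥ : ∀ n → inv2^ n ≤ inv2^ (suc n) + inv2^ (suc n)
inv2^-half-≥ n = ≤-intro (inv2^ n) (h + h)
  (λ i h+h≤zᴸ → h≰0 (begin
     h                   ≤⟨ x≤x+y h 0≤h ⟩
     h + h               ≤⟨ h+h≤zᴸ ⟩
     GL (inv2^ n) i      ≤⟨ inv2^-leftOption≤0 n i ⟩
     0G                  ∎))
  (+-elimᴿ h h (λ Y → ¬ Y ≤ inv2^ n)
    (λ { zero → x+y≰x (inv2^ n) h≰0 })
    (λ { zero h+z≤z → x+y≰x (inv2^ n) h≰0 (≤-trans (+-comm-≤ (inv2^ n) h) h+z≤z) }))
  where
  h : Game
  h = inv2^ (suc n)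
  0≤h : 0G ≤ h
  0≤h = proj₁ (inv2^-positive (suc n))
  h≰0 : ¬ h ≤ 0G
  h≰0 = proj₂ (inv2^-positive (suc n))

inv2^-half : ∀ n → inv2^ (suc n) + inv2^ (suc n) ≈ inv2^ n
inv2^-half n = inv2^-half-≤ n , inv2^-half-≥ n

int-mono : ∀ {N M} → N ≤ℕ M → int N ≤ int M
int-mono {zero} {zero} _ = ≤-refl
int-mono {zero} {suc M} _ = ≤-intro 0G (int (suc M)) (λ ()) (λ ())
int-mono {suc N} {suc M} (s≤s N≤M) = ≤-intro (int (suc N)) (int (suc M))
  (λ { zero M+1≤N → ∈ᴸ⇒≰ {int (suc M)} (zero , refl) (≤-trans M+1≤N (int-mono N≤M)) })
  (λ ())

≤-int : ∀ H → ∃[ N ] H ≤ int N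
≤-int H@(mk m L _ _) = suc N , ≤-intro H (int (suc N)) N+1≰Lᵢ (λ ())
  where
  N : ℕ
  N = max 0 (tabulate (λ i → proj₁ (≤-int (L i))))
  N+1≰Lᵢ : ∀ i → ¬ int (suc N) ≤ L i
  N+1≰Lᵢ i N+1≤Lᵢ = ∈ᴸ⇒≰ {int (suc N)} (zero , refl) (begin
    int (suc N)               ≤⟨ N+1≤Lᵢ ⟩
    L i                       ≤⟨ proj₂ (≤-int (L i)) ⟩
    int (proj₁ (≤-int (L i))) ≤⟨ int-mono (v≤max⁺ 0 _ (inj₂ (tabulate⁺ i ℕ.≤-refl))) ⟩
    int N                     ∎)

int-suc-≤ : ∀ N → int (suc N) ≤ int N + int 1
int-suc-≤ zero = proj₂ (+-identityˡ (int 1))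
int-suc-≤ (suc N) = ≤-intro (int (suc (suc N))) (int (suc N) + int 1)
  (λ { zero → x+y≰x (int (suc N)) (proj₂ (inv2^-positive 0)) })
  (λ ())

infixr 7 _·_
_·_ : ℕ → Game → Game
zero · x = 0G
suc n · x = n · x + x

int≤·1 : ∀ N → int N ≤ N · int 1
int≤·1 zero = ≤-refl
int≤·1 (suc N) = ≤-trans (int-suc-≤ N) (+-monoˡ-≤ (int 1) (int≤·1 N))

·-double : ∀ {x y} → x ≤ y + y → ∀ n → n · x ≤ (n +ℕ n) · y
·-double x≤2y zero = ≤-refl
·-double {x} {y} x≤2y (suc n) rewrite ℕ.+-suc n n = begin
  n · x + x              ≤⟨ +-mono-≤ (·-double x≤2y n) x≤2y ⟩
  (n +ℕ n) · y + (y + y) ≈⟨ +-assoc ((n +ℕ n) · y) y y ⟨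
  (n +ℕ n) · y + y + y   ∎

int≤·inv2^ : ∀ p N → ∃[ M ] int N ≤ M · inv2^ p
int≤·inv2^ zero N = N , int≤·1 N
int≤·inv2^ (suc p) N =
  let M , N≤M·x = int≤·inv2^ p N
  in  M +ℕ M , ≤-trans N≤M·x (·-double (inv2^-half-≥ p) M)

-- Representatives with a left gap

LeftGap : Game → Game → Set
LeftGap x C = ∀ i → GL C i + x ≤ C

·-leftGap : ∀ {x} → (∀ i → GL x i ≤ 0G) → ∀ n → LeftGap x (n · x)
·-leftGap xᴸ≤0 zero ()
·-leftGap {x} xᴸ≤0 (suc n) = +-elimᴸ (n · x) x (λ Y → Y + x ≤ n · x + x)
  (λ i → +-monoˡ-≤ x (·-leftGap xᴸ≤0 n i))
  (λ i → +-monoˡ-≤ x (begin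
     n · x + GL x i  ≤⟨ +-monoʳ-≤ (n · x) (xᴸ≤0 i) ⟩
     n · x + 0G      ≈⟨ +-identityʳ (n · x) ⟩
     n · x           ∎))

¬¬-threshold : ∀ (Q : ℕ → Set) → ¬ Q 0 → ∀ n → Q n → ¬ ¬ (∃[ m ] ¬ Q m × Q (suc m))
¬¬-threshold Q ¬Q0 zero Q0 _ = ¬Q0 Q0
¬¬-threshold Q ¬Q0 (suc n) Q[1+n] ¬∃ = ¬∃ (n , (λ Qn → ¬¬-threshold Q ¬Q0 n Qn ¬∃) , Q[1+n])

¬¬-leftGapRepresentative : ∀ p G → (∀ j → G + inv2^ p ≤ GR G j) →
                           ¬ ¬ (∃[ C ] C ≈ G × LeftGap (inv2^ p) C)
¬¬-leftGapRepresentative p G G+x≤Gᴿ =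
  ¬¬-map representative (¬¬-threshold Below ¬Below-0 M Below-M)
  where
  x : Game
  x = inv2^ p
  -- J exceeds -G and has no Right options, so -J has no Left options.
  J : Game
  J = mk 1 (λ _ → - G) 0 (λ ())
  Below : ℕ → Set
  Below m = G + J ≤ m · x
  ¬Below-0 : ¬ Below 0
  ¬Below-0 G+J≤0 = ∈ᴸ⇒≰ {J} (zero , refl) (begin
    J       ≤⟨ x+y≤z⇒x≤z-y G (≤-trans (+-comm-≤ J G) G+J≤0) ⟩
    0G - G  ≈⟨ +-identityˡ (- G) ⟩
    - G     ∎)
  M : ℕ
  M = proj₁ (int≤·inv2^ p (proj₁ (≤-int (G + J))))
  Below-M : Below M
  Below-M = ≤-trans (proj₂ (≤-int (G + J))) (proj₂ (int≤·inv2^ p _))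
  representative : (∃[ m ] ¬ Below m × Below (suc m)) → ∃[ C ] C ≈ G × LeftGap x C
  representative (m , ¬Below-m , Below-1+m) = D - J , (C≤G , G≤C) , gap
    where
    D : Game
    D = suc m · x
    C≤G : D - J ≤ G
    C≤G = ≤-intro (D - J) G
      (+-elimᴸ D (- J) (λ Y → ¬ G ≤ Y)
        (λ i G≤Dᴸ-J → ¬Below-m (+-cancelʳ-≤ x (begin
          (G + J) + x  ≤⟨ +-monoˡ-≤ x (x≤z-y⇒x+y≤z J G≤Dᴸ-J) ⟩
          GL D i + x   ≤⟨ ·-leftGap (inv2^-leftOption≤0 p) (suc m) i ⟩
          m · x + x    ∎)))
        (λ ()))
      (λ j Gᴿ≤D-J → ¬Below-m (+-cancelʳ-≤ x (begin
        (G + J) + x  ≈⟨ xy∙z≈xz∙y G J x ⟩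
        (G + x) + J  ≤⟨ +-monoˡ-≤ J (G+x≤Gᴿ j) ⟩
        GR G j + J   ≤⟨ x≤z-y⇒x+y≤z J Gᴿ≤D-J ⟩
        m · x + x    ∎)))
    G≤C : G ≤ D - J
    G≤C = x+y≤z⇒x≤z-y J Below-1+m
    gap : LeftGap x (D - J)
    gap = +-elimᴸ D (- J) (λ Y → Y + x ≤ D - J)
      (λ i → begin
        (GL D i - J) + x  ≈⟨ xy∙z≈xz∙y (GL D i) (- J) x ⟩
        (GL D i + x) - J  ≤⟨ +-monoˡ-≤ (- J) (·-leftGap (inv2^-leftOption≤0 p) (suc m) i) ⟩
        D - J             ∎)
      (λ ())

-- Ordinal sums with an integer

module _ (a b : Game) where

  private
    X : ℕ → Game
    X k = ⟨ a ∣ b ⟩ ∶ int k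

  a∈ᴸX : ∀ k → a ∈ᴸ X k
  a∈ᴸX zero = zero , refl
  a∈ᴸX (suc k) = zero , refl

  X∈ᴸX-suc : ∀ k → X k ∈ᴸ X (suc k)
  X∈ᴸX-suc k = suc zero , refl

  b∈ᴿX : ∀ k → b ∈ᴿ X k
  b∈ᴿX zero = zero , refl
  b∈ᴿX (suc k) = zero , refl

  GR-X≡b : ∀ k j → GR (X k) j ≡ b
  GR-X≡b zero zero = refl
  GR-X≡b (suc k) zero = refl

  X-zero : X 0 ≈ ⟨ a ∣ b ⟩
  X-zero =
    ≤-byOptions (X 0) ⟨ a ∣ b ⟩
      (λ { zero → a , (zero , refl) , ≤-refl }) (λ { zero → b , (zero , refl) , ≤-refl }) ,
    ≤-byOptions ⟨ a ∣ b ⟩ (X 0)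
      (λ { zero → a , (zero , refl) , ≤-refl }) (λ { zero → b , (zero , refl) , ≤-refl })

  X-suc-≤ : ∀ k n → b ≤ X k + inv2^ n → X (suc k) ≤ X k + inv2^ (suc n)
  X-suc-≤ k n b≤Xₖ+s = ≤-intro (X (suc k)) (X k + t)
    (λ { zero Xₖ+t≤a → ∈ᴸ⇒≰ (a∈ᴸX k) (≤-trans (x≤x+y (X k) 0≤t) Xₖ+t≤a)
       ; (suc zero) → x+y≰x (X k) t≰0 })
    (+-elimᴿ (X k) t (λ Y → ¬ Y ≤ X (suc k))
      (λ j → subst (λ Y → ¬ Y + t ≤ X (suc k)) (sym (GR-X≡b k j))
         λ b+t≤Xₖ₊₁ → ∈ᴿ⇒≰ (b∈ᴿX (suc k)) (≤-trans (x≤x+y b 0≤t) b+t≤Xₖ₊₁))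
      (λ { zero Xₖ+s≤Xₖ₊₁ → ∈ᴿ⇒≰ (b∈ᴿX (suc k)) (≤-trans b≤Xₖ+s Xₖ+s≤Xₖ₊₁) }))
    where
    t : Game
    t = inv2^ (suc n)
    0≤t : 0G ≤ t
    0≤t = proj₁ (inv2^-positive (suc n))
    t≰0 : ¬ t ≤ 0G
    t≰0 = proj₂ (inv2^-positive (suc n))

  X-suc-≥ : ∀ p k n {C} → LeftGap (inv2^ p) C → inv2^ n ≤ inv2^ p → C + inv2^ p ≤ b →
            X k ≈ (C + inv2^ p) - inv2^ n → (C + inv2^ p) - inv2^ (suc n) ≤ X (suc k)
  X-suc-≥ p k n {C} gap s≤x C+x≤b Xₖ≈C+x-s = ≤-intro ((C + x) - t) (X (suc k))
    (+-elimᴸ (C + x) (- t) (λ Y → ¬ X (suc k) ≤ Y)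
      (+-elimᴸ C x (λ Y → ¬ X (suc k) ≤ Y - t)
        (λ i → below-Xₖ (≤-trans (+-monoˡ-≤ (- t) (gap i)) C-t≤Xₖ))
        (λ i → below-Xₖ (≤-trans (+-monoˡ-≤ (- t) (C+xᴸ≤C i)) C-t≤Xₖ)))
      (λ { zero → below-Xₖ (proj₂ Xₖ≈C+x-s) }))
    (λ { zero b≤C+x-t → x+y≰x (C + x) t≰0 (x≤z-y⇒x+y≤z t (≤-trans C+x≤b b≤C+x-t)) })
    where
    x s t : Game
    x = inv2^ p
    s = inv2^ n
    t = inv2^ (suc n)
    0≤t : 0G ≤ t
    0≤t = proj₁ (inv2^-positive (suc n))
    t≰0 : ¬ t ≤ 0G
    t≰0 = proj₂ (inv2^-positive (suc n))
    below-Xₖ : ∀ {Y} → Y ≤ X k → ¬ X (suc k) ≤ Y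
    below-Xₖ Y≤Xₖ Xₖ₊₁≤Y = ∈ᴸ⇒≰ (X∈ᴸX-suc k) (≤-trans Xₖ₊₁≤Y Y≤Xₖ)
    C+xᴸ≤C : ∀ i → C + GL x i ≤ C
    C+xᴸ≤C i = begin
      C + GL x i  ≤⟨ +-monoʳ-≤ C (inv2^-leftOption≤0 p i) ⟩
      C + 0G      ≈⟨ +-identityʳ C ⟩
      C           ∎
    C-t≤Xₖ : C - t ≤ X k
    C-t≤Xₖ = begin
      C - t        ≤⟨ +-monoʳ-≤ C (begin
        - t          ≤⟨ neg-antimono-≤ 0≤t ⟩
        - 0G         ≈⟨ ε⁻¹≈ε ⟩
        0G           ≈⟨ +-inverseʳ s ⟨
        s - s        ≤⟨ +-monoˡ-≤ (- s) s≤x ⟩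
        x - s        ∎) ⟩
      C + (x - s)  ≈⟨ +-assoc C x (- s) ⟨
      (C + x) - s  ≈⟨ Xₖ≈C+x-s ⟨
      X k          ∎

  X-suc≈ : ∀ p k n {C} → C + inv2^ p ≈ b → LeftGap (inv2^ p) C → inv2^ n ≤ inv2^ p →
           X k ≈ b - inv2^ n → X (suc k) ≈ b - inv2^ (suc n)
  X-suc≈ p k n {C} C+x≈b gap s≤x Xₖ≈b-s =
    (begin
      X (suc k)   ≤⟨ X-suc-≤ k n b≤Xₖ+s ⟩
      X k + t     ≈⟨ +-congʳ Xₖ≈b-s ⟩
      (b - s) + t ≈⟨ b-s+t≈b-t ⟩
      b - t       ∎) ,
    (begin
      b - t             ≈⟨ +-congʳ C+x≈b ⟨
      (C + x) - t       ≤⟨ X-suc-≥ p k n gap s≤x (proj₁ C+x≈b) Xₖ≈C+x-s ⟩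
      X (suc k)         ∎)
    where
    x s t : Game
    x = inv2^ p
    s = inv2^ n
    t = inv2^ (suc n)
    Xₖ≈C+x-s : X k ≈ (C + x) - s
    Xₖ≈C+x-s = ≈-trans Xₖ≈b-s (+-congʳ (≈-sym C+x≈b))
    b≤Xₖ+s : b ≤ X k + s
    b≤Xₖ+s = begin
      b            ≈⟨ //-rightDividesˡ s b ⟨
      (b - s) + s  ≈⟨ +-congʳ Xₖ≈b-s ⟨
      X k + s      ∎
    b-s+t≈b-t : (b - s) + t ≈ b - t
    b-s+t≈b-t = x≈z//y ((b - s) + t) t b (begin-equality
      ((b - s) + t) + t  ≈⟨ +-assoc (b - s) t t ⟩
      (b - s) + (t + t)  ≈⟨ +-congˡ (inv2^-half n) ⟩
      (b - s) + s        ≈⟨ //-rightDividesˡ s b ⟩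
      b                  ∎)

  X≈b-inv2^ : ∀ p {C} → b ≈ ⟨ a ∣ b ⟩ + inv2^ p → C ≈ ⟨ a ∣ b ⟩ → LeftGap (inv2^ p) C →
              ∀ k → X k ≈ b - inv2^ (p +ℕ k)
  X≈b-inv2^ p b≈G+x C≈G gap zero rewrite ℕ.+-identityʳ p = begin-equality
    X 0                            ≈⟨ X-zero ⟩
    ⟨ a ∣ b ⟩                      ≈⟨ //-rightDividesʳ (inv2^ p) ⟨ a ∣ b ⟩ ⟨
    (⟨ a ∣ b ⟩ + inv2^ p) - inv2^ p ≈⟨ +-congʳ b≈G+x ⟨
    b - inv2^ p                    ∎
  X≈b-inv2^ p b≈G+x C≈G gap (suc k) rewrite ℕ.+-suc p k =
    X-suc≈ p k (p +ℕ k) (≈-trans (+-congʳ C≈G) (≈-sym b≈G+x)) gap (inv2^-antimono p k)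
      (X≈b-inv2^ p b≈G+x C≈G gap k)

corollary4p3 : (a b : Game) (p : ℕ)
    → IsNumber a → IsNumber b → IsNumber ⟨ a ∣ b ⟩
    → (b - ⟨ a ∣ b ⟩) ≈ inv2^ p
    → (k : ℕ) → 0 <ℕ k
    → (⟨ a ∣ b ⟩ ∶ int k) ≈ ((⟨ a ∣ b ⟩ + inv2^ p) - inv2^ (p +ℕ k))
corollary4p3 a b p _ _ _ b-G≈x k _ =
  ≈-stable (¬¬-map conclusion (¬¬-leftGapRepresentative p G (λ { zero → proj₂ b≈G+x })))
  where
  G : Game
  G = ⟨ a ∣ b ⟩
  b≈G+x : b ≈ G + inv2^ p
  b≈G+x = begin-equality
    b            ≈⟨ //-rightDividesˡ G b ⟨
    (b - G) + G  ≈⟨ +-congʳ b-G≈x ⟩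
    inv2^ p + G  ≈⟨ +-comm (inv2^ p) G ⟩
    G + inv2^ p  ∎
  conclusion : (∃[ C ] C ≈ G × LeftGap (inv2^ p) C) → G ∶ int k ≈ (G + inv2^ p) - inv2^ (p +ℕ k)
  conclusion (C , C≈G , gap) = ≈-trans (X≈b-inv2^ a b p b≈G+x C≈G gap k) (+-congʳ b≈G+x)
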